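{- Let $t=2$, $p=\binom{2t}{t}-1=5$, and let $q$ be a positive integer with $q\ne 1$ and $q\ne 3$. Then for no positive integer $k$ is $C_{p,q}$ a submatrix of $A_{k,t}$.
   Context: For positive integers $k,t$ with $k\ge t$, $A_{k,t}$ is the $0,1$-matrix of size $\binom{k}{t}\times\binom{k}{t}$ whose rows and columns are indexed by all $t$-element subsets of $[k]=\{1,\dots,k\}$, with entry $1$ in row $x$, column $y$ if and only if $x\cap y\neq\emptyset$. For integers $p\ge 1$, $q\ge 0$ and $n=p+q$, $C_{p,q}$ is the $n\times n$ circulant $0,1$-matrix whose entry in row $i$, column $j$ ($1\le i,j\le n$) is $1$ iff $(i-j) \bmod n \in\{0,1,\dots,p-1\}$. An $n\times m$ $0,1$-matrix $M$ is a submatrix of $A_{k,t}$ if there are distinct $t$-subsets $F_1,\dots,F_n$ of $[k]$ and distinct $t$-subsets $G_1,\dots,G_m$ of $[k]$ with $M_{ij}=1$ iff $F_i\cap G_j\ne\emptyset$. -}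

module Defs where

open import Data.Nat using (ℕ; zero; suc; _+_; _∸_; _<_; NonZero)
open import Data.Nat.DivMod using (_%_)
open import Data.Nat.Combinatorics using (_C_)
open import Data.Fin using (Fin; toℕ)
open import Data.Fin.Subset using (Subset; _∩_; ∣_∣; Nonempty)
open import Data.Product using (Σ; _×_)
open import Data.Bool using (Bool; true; false)
open import Relation.Nullary using (¬_)
open import Relation.Binary.PropositionalEquality using (_≡_)
open import Function.Definitions using (Injective)

Matrix : ℕ → ℕ → Set
Matrix n m = Fin n → Fin m → Bool

TSubset : ℕ → ℕ → Set
TSubset k t = Σ (Subset k) (λ F → ∣ F ∣ ≡ t)

-- (i - j) mod n, for i, j ∈ {0,…,n-1}  (0-indexed rows/columns;
-- differences are the same as with 1-indexing).
diffMod : (n : ℕ) → .{{NonZero n}} → Fin n → Fin n → ℕ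
diffMod n i j = ((n + toℕ i) ∸ toℕ j) % n

Circ : (p q : ℕ) → .{{NonZero (p + q)}} → Matrix (p + q) (p + q)
Circ p q i j = isLess (diffMod (p + q) i j)
  where
  isLess : ℕ → Bool
  isLess d with Data.Nat._<?_ d p
  ... | Relation.Nullary.yes _ = true
  ... | Relation.Nullary.no _ = false

IsSubmatrixOfA : (k t : ℕ) {n m : ℕ} → Matrix n m → Set
IsSubmatrixOfA k t {n} {m} M =
  Σ (Fin n → TSubset k t) λ F →
  Σ (Fin m → TSubset k t) λ G →
    Injective _≡_ _≡_ F × Injective _≡_ _≡_ G ×
    (∀ i j → (M i j ≡ true → Nonempty (Data.Product.proj₁ (F i) ∩ Data.Product.proj₁ (G j)))
           × (Nonempty (Data.Product.proj₁ (F i) ∩ Data.Product.proj₁ (G j)) → M i j ≡ true))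

-- Forgetting distinctness, a copy of M inside A_{k,2} assigns a pair of
-- elements to every row and column so that a row pair and a column pair share
-- an element exactly at the 1-entries of M.  Whether such an assignment exists
-- depends only on which entries coincide, so it is decided by a finite search
-- over identifications of symbolic names: each 1-entry forces one of four
-- coincidences, and a branch dies once some 0-entry is forced to intersect.
-- The two sides of a pair whose names are still unconstrained are
-- interchangeable, which keeps the search small.  The search refutes C_{5,2}
-- and C_{5,4}, and for q ≥ 5 it refutes the top-left 6 × 6 block of C_{5,q},
-- which is the same band matrix for all such q.

module Submission where

open import Level using (Level)
open import Data.Bool using (Bool; true; false; not; T; _∧_; _∨_; if_then_else_)
open import Data.Bool.Properties using (T-≡; T-∨) renaming (_≟_ to _≟ᵇ_)
open import Data.Fin using (Fin; zero; suc; toℕ; fromℕ<; inject≤; _↑ˡ_; _↑ʳ_; splitAt) renaming (_≟_ to _≟ᶠ_)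
open import Data.Fin.Properties
  using (all?; fromℕ<-toℕ; toℕ≤pred[n]; toℕ-inject≤; toℕ<n; splitAt-↑ˡ; splitAt-↑ʳ)
open import Data.Fin.Subset using (Subset; _∈_; _∉_; _∩_; ∣_∣; Nonempty; inside; outside)
open import Data.Vec.Base using (_∷_; here; there)
open import Data.Fin.Subset.Properties using (x∈p∩q⁺; x∈p∩q⁻)
open import Data.Bool.ListAction using (all)
open import Data.List using (List; []; _∷_; filterᵇ; cartesianProduct; allFin)
import Data.List as List
open import Data.List.Membership.Propositional using () renaming (_∈_ to _∈ˡ_)
open import Data.List.Membership.Propositional.Properties using (∈-cartesianProduct⁺)
open import Data.List.Relation.Unary.All as All using (All; []; _∷_)
open import Data.List.Relation.Unary.All.Properties using (all⁺; all-filter; map⁺; All¬⇒¬Any)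
open import Data.List.Relation.Unary.Any as Any using (Any; here; there; any?)
open import Data.Nat using (ℕ; suc; _+_; _∸_; _≤_; _<_; _≤?_; _<?_; NonZero)
open import Data.Nat.Combinatorics using (_C_)
open import Data.Nat.DivMod using (_%_; [m+n]%n≡m%n; m<n⇒m%n≡m)
import Data.Nat.Properties as ℕ
open import Data.Nat.Properties
  using (+-comm; +-∸-assoc; m∸n≤m; ≤-trans; m≤m+n; m+n∸n≡m; ∸-monoˡ-≤; ∸-monoʳ-≤; ∸-monoʳ-<;
         ≰⇒>; suc-injective)
open import Data.Product using (∃; ∃₂; _×_; _,_; proj₁; proj₂; swap; uncurry)
import Data.Product as Product
open import Data.Product.Properties using (×-≡,≡→≡; ×-≡,≡←≡)
open import Data.Sum using (_⊎_; inj₁; inj₂; [_,_]′)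
open import Data.Vec using (Vec; lookup; tabulate)
import Data.Vec as Vec
open import Data.Vec.Properties using (lookup-map; lookup∘tabulate)
open import Function using (_∘_; id; _⇔_; mk⇔; Equivalence)
open import Relation.Binary.Definitions using (DecidableEquality)
open import Relation.Binary.PropositionalEquality
  using (_≡_; _≢_; refl; sym; trans; cong; cong₂; subst; subst₂; module ≡-Reasoning)
open import Relation.Nullary using (¬_; Dec; yes; no; does; contradiction; ¬?)
open import Relation.Nullary.Decidable using (map′; _×-dec_; _⊎-dec_; isYes; toWitness; T?; dec-true; dec-false)

open import Defs

open Equivalence using (to; from)

private
  variable
    a : Level
    A B : Set a
    k n m n′ m′ N : ℕ

-- Pairs and when they meet

infixl 9 _‼_
_‼_ : A × A → Bool → A
(x , _) ‼ false = x
(_ , y) ‼ true  = y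

map² : (A → B) → A × A → B × B
map² f = Product.map f f

‼-map² : (f : A → B) (P : A × A) (b : Bool) → map² f P ‼ b ≡ f (P ‼ b)
‼-map² f P false = refl
‼-map² f P true  = refl

Meet : A × A → A × A → Set _
Meet P Q = ∃₂ λ b c → P ‼ b ≡ Q ‼ c

∃-Bool? : {R : Bool → Set a} → ((b : Bool) → Dec (R b)) → Dec (∃ R)
∃-Bool? R? = map′ [ (false ,_) , (true ,_) ]′ (λ { (false , r) → inj₁ r ; (true , r) → inj₂ r })
                  (R? false ⊎-dec R? true)

meet? : DecidableEquality A → (P Q : A × A) → Dec (Meet P Q)
meet? _≟_ P Q = ∃-Bool? λ b → ∃-Bool? λ c → (P ‼ b) ≟ (Q ‼ c)

Meet-refl : (P : A × A) → Meet P P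
Meet-refl P = false , false , refl

Meet-map² : (f : A → B) {P Q : A × A} → Meet P Q → Meet (map² f P) (map² f Q)
Meet-map² f {P} {Q} (b , c , e) = b , c , (begin
  map² f P ‼ b  ≡⟨ ‼-map² f P b ⟩
  f (P ‼ b)     ≡⟨ cong f e ⟩
  f (Q ‼ c)     ≡⟨ ‼-map² f Q c ⟨
  map² f Q ‼ c  ∎)
  where open ≡-Reasoning

Meet-swapˡ : {P Q : A × A} → Meet P Q → Meet (swap P) Q
Meet-swapˡ (false , c , e) = true , c , e
Meet-swapˡ (true  , c , e) = false , c , e

Meet-swapʳ : {P Q : A × A} → Meet P Q → Meet P (swap Q)
Meet-swapʳ (b , false , e) = b , true , e
Meet-swapʳ (b , true  , e) = b , false , e

infix 4 _≈_
_≈_ : A × A → A × A → Set _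
P ≈ Q = P ≡ Q ⊎ P ≡ swap Q

≈-sym : {P Q : A × A} → P ≈ Q → Q ≈ P
≈-sym (inj₁ refl) = inj₁ refl
≈-sym (inj₂ refl) = inj₂ refl

Meet-resp-≈ : {P P′ Q Q′ : A × A} → P ≈ P′ → Q ≈ Q′ → Meet P Q → Meet P′ Q′
Meet-resp-≈ (inj₁ refl) (inj₁ refl) = id
Meet-resp-≈ (inj₁ refl) (inj₂ refl) = Meet-swapʳ
Meet-resp-≈ (inj₂ refl) (inj₁ refl) = Meet-swapˡ
Meet-resp-≈ (inj₂ refl) (inj₂ refl) = Meet-swapˡ ∘ Meet-swapʳ

Edge : ℕ → Set
Edge N = Fin N × Fin N

Meets : (Fin N → A × A) → Edge N → Set _
Meets σ (u , w) = Meet (σ u) (σ w)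

Satisfies : (Fin N → A × A) → List (Edge N) → List (Edge N) → Set _
Satisfies σ hs ms = All (Meets σ) hs × All (¬_ ∘ Meets σ) ms

Satisfies-resp-≈ : {σ σ′ : Fin N → A × A} {hs ms : List (Edge N)} →
                   (∀ u → σ u ≈ σ′ u) → Satisfies σ hs ms → Satisfies σ′ hs ms
Satisfies-resp-≈ σ≈σ′ (hits , misses) =
  All.map (λ {(u , w)} → Meet-resp-≈ (σ≈σ′ u) (σ≈σ′ w)) hits ,
  All.map (λ {(u , w)} ¬m → ¬m ∘ Meet-resp-≈ (≈-sym (σ≈σ′ u)) (≈-sym (σ≈σ′ w))) misses

-- Symbolic search for a refutation

-- A labelling names the two entries of every pair.  In the initial
-- labelling the side b of vertex v is named (toℕ v , b), so all names differ.
Name : Set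
Name = ℕ × Bool

infix 4 _≟ₙ_
_≟ₙ_ : DecidableEquality Name
x ≟ₙ y = map′ ×-≡,≡→≡ ×-≡,≡←≡ (proj₁ x ℕ.≟ proj₁ y ×-dec proj₂ x ≟ᵇ proj₂ y)

Labelling : ℕ → Set
Labelling N = Vec (Name × Name) N

⟦_⟧ : Labelling N → (Name → A) → Fin N → A × A
⟦ l ⟧ ρ v = map² ρ (lookup l v)

initial : Labelling N
initial = tabulate λ v → (toℕ v , false) , (toℕ v , true)

_[_≔_] : (Name → A) → Name → A → Name → A
(f [ x ≔ y ]) z = if does (z ≟ₙ x) then y else f z

[≔]-at : (f : Name → A) (x : Name) (y : A) → (f [ x ≔ y ]) x ≡ y
[≔]-at f x y = cong (if_then y else f x) (dec-true (x ≟ₙ x) refl)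

[≔]-off : (f : Name → A) {x z : Name} (y : A) → z ≢ x → (f [ x ≔ y ]) z ≡ f z
[≔]-off f {x} {z} y z≢x = cong (if_then y else f z) (dec-false (z ≟ₙ x) z≢x)

identify : Name → Name → Labelling N → Labelling N
identify x y = Vec.map (map² (id [ x ≔ y ]))

⟦identify⟧ : (l : Labelling N) (ρ : Name → A) {x y : Name} → ρ x ≡ ρ y →
             ∀ v → ⟦ identify x y l ⟧ ρ v ≡ ⟦ l ⟧ ρ v
⟦identify⟧ l ρ {x} {y} ρx≡ρy v = begin
  map² ρ (lookup (identify x y l) v)     ≡⟨ cong (map² ρ) (lookup-map v (map² rename) l) ⟩
  map² (ρ ∘ rename) (lookup l v)          ≡⟨ cong₂ _,_ (ρ∘rename (proj₁ (lookup l v)))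
                                                       (ρ∘rename (proj₂ (lookup l v))) ⟩
  map² ρ (lookup l v)                     ∎
  where
  open ≡-Reasoning
  rename = id [ x ≔ y ]
  ρ∘rename : ∀ z → ρ (rename z) ≡ ρ z
  ρ∘rename z = by-cases (z ≟ₙ x)
    where
    by-cases : Dec (z ≡ x) → ρ (rename z) ≡ ρ z
    by-cases (yes refl) = trans (cong ρ ([≔]-at id x y)) (sym ρx≡ρy)
    by-cases (no z≢x)   = cong ρ ([≔]-off id y z≢x)

Fresh : Labelling N → Fin N → Set
Fresh l v = (∀ u → u ≡ v ⊎ ¬ Meets (lookup l) (u , v)) × (lookup l v ‼ false ≢ lookup l v ‼ true)

fresh? : (l : Labelling N) (v : Fin N) → Dec (Fresh l v)
fresh? l v = all? (λ u → u ≟ᶠ v ⊎-dec ¬? (meet? _≟ₙ_ (lookup l u) (lookup l v)))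
             ×-dec ¬? (lookup l v ‼ false ≟ₙ lookup l v ‼ true)

sidesFor : {P : Set} → Dec P → List Bool
sidesFor (yes _) = false ∷ []
sidesFor (no _)  = false ∷ true ∷ []

false∈sidesFor : {P : Set} (d : Dec P) → false ∈ˡ sidesFor d
false∈sidesFor (yes _) = here refl
false∈sidesFor (no _)  = here refl

∈sidesFor : {P : Set} → ¬ P → (d : Dec P) (b : Bool) → b ∈ˡ sidesFor d
∈sidesFor ¬p (yes p) b     = contradiction p ¬p
∈sidesFor ¬p (no _)  false = here refl
∈sidesFor ¬p (no _)  true  = there (here refl)

sides : Labelling N → Fin N → List Bool
sides l v = sidesFor (fresh? l v)

violation? : (l : Labelling N) (ms : List (Edge N)) → Dec (Any (Meets (lookup l)) ms)
violation? l = any? λ (u , w) → meet? _≟ₙ_ (lookup l u) (lookup l w)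

violated : Labelling N → List (Edge N) → Bool
violated l ms = isYes (violation? l ms)

-- A hit whose pairs do not yet share a name is split into the ways they can
-- meet, each identifying two names; a branch is closed once a miss is forced.
mutual
  refutes : Labelling N → List (Edge N) → List (Edge N) → Bool
  refutes l ms []             = false
  refutes l ms ((u , w) ∷ hs) = refutesSplit l ms u w hs (meet? _≟ₙ_ (lookup l u) (lookup l w))

  refutesSplit : (l : Labelling N) → List (Edge N) → (u w : Fin N) → List (Edge N) →
                 Dec (Meets (lookup l) (u , w)) → Bool
  refutesSplit l ms u w hs (yes _) = refutes l ms hs
  refutesSplit l ms u w hs (no _)  =
    all (λ (b , c) → let l′ = identify (lookup l u ‼ b) (lookup l w ‼ c) l
                     in violated l′ ms ∨ refutes l′ ms hs)
        (cartesianProduct (sides l u) (sides l w))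

violated-sound : (l : Labelling N) (ms : List (Edge N)) (ρ : Name → A) →
                 T (violated l ms) → ¬ All (¬_ ∘ Meets (⟦ l ⟧ ρ)) ms
violated-sound l ms ρ vio misses =
  All¬⇒¬Any misses (Any.map (λ {(u , w)} → Meet-map² ρ) (toWitness vio))

-- The without-loss-of-generality step: at a fresh vertex v, ρ may be changed
-- (swapping the pair of v) so that side b of v becomes a side in sides l v.
record Reoriented {a} {A : Set a} (l : Labelling N) (ρ : Name → A) (v : Fin N) (b : Bool) : Set a where
  field
    side      : Bool
    side∈     : side ∈ˡ sides l v
    ρ′        : Name → A
    at-v      : ρ′ (lookup l v ‼ side) ≡ ρ (lookup l v ‼ b)
    elsewhere : ∀ u c → u ≢ v → ρ′ (lookup l u ‼ c) ≡ ρ (lookup l u ‼ c)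
    similar   : ∀ u → ⟦ l ⟧ ρ u ≈ ⟦ l ⟧ ρ′ u

unchanged : {l : Labelling N} {ρ : Name → A} {v : Fin N} {b : Bool} → b ∈ˡ sides l v → Reoriented l ρ v b
unchanged {ρ = ρ} {b = b} b∈ = record { side = b ; side∈ = b∈ ; ρ′ = ρ ; at-v = refl
                                      ; elsewhere = λ _ _ _ → refl ; similar = λ _ → inj₁ refl }

reorient : (l : Labelling N) (ρ : Name → A) (v : Fin N) (b : Bool) → Reoriented l ρ v b
reorient l ρ v false = unchanged (false∈sidesFor (fresh? l v))
reorient l ρ v true with fresh? l v
... | no ¬fresh = unchanged (∈sidesFor ¬fresh (fresh? l v) true)
... | yes (isolated , x≢y) = record
  { side = false ; side∈ = false∈sidesFor (fresh? l v) ; ρ′ = ρ′ ; at-v = ρ′x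
  ; elsewhere = elsewhere ; similar = similar }
  where
  x = lookup l v ‼ false
  y = lookup l v ‼ true
  ρ₁ = ρ [ x ≔ ρ y ]
  ρ′ = ρ₁ [ y ≔ ρ x ]

  ρ′x : ρ′ x ≡ ρ y
  ρ′x = trans ([≔]-off ρ₁ (ρ x) x≢y) ([≔]-at ρ x (ρ y))

  ρ′y : ρ′ y ≡ ρ x
  ρ′y = [≔]-at ρ₁ y (ρ x)

  apart : ∀ u c s → u ≢ v → lookup l u ‼ c ≢ lookup l v ‼ s
  apart u c s u≢v eq with isolated u
  ... | inj₁ u≡v  = u≢v u≡v
  ... | inj₂ ¬met = ¬met (c , s , eq)

  elsewhere : ∀ u c → u ≢ v → ρ′ (lookup l u ‼ c) ≡ ρ (lookup l u ‼ c)
  elsewhere u c u≢v =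
    trans ([≔]-off ρ₁ (ρ x) (apart u c true u≢v)) ([≔]-off ρ (ρ y) (apart u c false u≢v))

  similar : ∀ u → ⟦ l ⟧ ρ u ≈ ⟦ l ⟧ ρ′ u
  similar u with u ≟ᶠ v
  ... | yes refl = inj₂ (cong₂ _,_ (sym ρ′y) (sym ρ′x))
  ... | no u≢v   = inj₁ (cong₂ _,_ (sym (elsewhere u false u≢v)) (sym (elsewhere u true u≢v)))

mutual
  refutes-sound : (l : Labelling N) (ms hs : List (Edge N)) (ρ : Name → A) →
                  T (refutes l ms hs) → ¬ Satisfies (⟦ l ⟧ ρ) hs ms
  refutes-sound l ms ((u , w) ∷ hs) ρ =
    refutesSplit-sound l ms u w hs ρ (meet? _≟ₙ_ (lookup l u) (lookup l w))

  refutesSplit-sound : (l : Labelling N) (ms : List (Edge N)) (u w : Fin N) (hs : List (Edge N))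
                       (ρ : Name → A) (d : Dec (Meets (lookup l) (u , w))) →
                       T (refutesSplit l ms u w hs d) → ¬ Satisfies (⟦ l ⟧ ρ) ((u , w) ∷ hs) ms
  refutesSplit-sound l ms u w hs ρ (yes _) ref (_ ∷ hits , misses) =
    refutes-sound l ms hs ρ ref (hits , misses)
  refutesSplit-sound l ms u w hs ρ (no ¬named) ref (uw-meets ∷ hits , misses) =
    [ (λ v → violated-sound l′ ms ρ₂ v (proj₂ sat′)) , (λ r → refutes-sound l′ ms hs ρ₂ r sat′) ]′
      (to T-∨ (All.lookup (all⁺ _ _ ref) (∈-cartesianProduct⁺ (side∈ R₁) (side∈ R₂))))
    where
    open Reoriented
    open ≡-Reasoning
    u≢w : u ≢ w
    u≢w refl = ¬named (Meet-refl (lookup l u))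
    b = proj₁ uw-meets
    c = proj₁ (proj₂ uw-meets)
    R₁ = reorient l ρ u b
    R₂ = reorient l (ρ′ R₁) w c
    ρ₂ = ρ′ R₂
    x = lookup l u ‼ side R₁
    y = lookup l w ‼ side R₂
    l′ = identify x y l

    ρ₂x≡ρ₂y : ρ₂ x ≡ ρ₂ y
    ρ₂x≡ρ₂y = begin
      ρ₂ x                   ≡⟨ elsewhere R₂ u (side R₁) u≢w ⟩
      ρ′ R₁ x                ≡⟨ at-v R₁ ⟩
      ρ (lookup l u ‼ b)     ≡⟨ ‼-map² ρ (lookup l u) b ⟨
      ⟦ l ⟧ ρ u ‼ b          ≡⟨ proj₂ (proj₂ uw-meets) ⟩
      ⟦ l ⟧ ρ w ‼ c          ≡⟨ ‼-map² ρ (lookup l w) c ⟩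
      ρ (lookup l w ‼ c)     ≡⟨ elsewhere R₁ w c (u≢w ∘ sym) ⟨
      ρ′ R₁ (lookup l w ‼ c) ≡⟨ at-v R₂ ⟨
      ρ₂ y                   ∎

    sat′ : Satisfies (⟦ l′ ⟧ ρ₂) hs ms
    sat′ = Satisfies-resp-≈ (λ v → inj₁ (sym (⟦identify⟧ l ρ₂ ρ₂x≡ρ₂y v)))
             (Satisfies-resp-≈ (similar R₂) (Satisfies-resp-≈ (similar R₁) (hits , misses)))

-- Realising a 0,1-matrix by pairs

Realises : Matrix n m → (Fin n → A × A) → (Fin m → A × A) → Set _
Realises M f g = ∀ i j → M i j ≡ true ⇔ Meet (f i) (g j)

Realises-submatrix : {M : Matrix n m} {M′ : Matrix n′ m′} {f : Fin n → A × A} {g : Fin m → A × A}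
                     (ι : Fin n′ → Fin n) (κ : Fin m′ → Fin m) → (∀ i j → M′ i j ≡ M (ι i) (κ j)) →
                     Realises M f g → Realises M′ (f ∘ ι) (g ∘ κ)
Realises-submatrix ι κ M′≡M real i j =
  mk⇔ (to (real (ι i) (κ j)) ∘ trans (sym (M′≡M i j))) (trans (M′≡M i j) ∘ from (real (ι i) (κ j)))

cells : (n m : ℕ) → List (Fin n × Fin m)
cells n m = cartesianProduct (allFin n) (allFin m)

edge : Fin n × Fin m → Edge (n + m)
edge {n} {m} (i , j) = i ↑ˡ m , n ↑ʳ j

hitsOf missesOf : Matrix n m → List (Edge (n + m))
hitsOf   {n} {m} M = List.map edge (filterᵇ (uncurry M) (cells n m))
missesOf {n} {m} M = List.map edge (filterᵇ (not ∘ uncurry M) (cells n m))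

joint : (Fin n → A × A) → (Fin m → A × A) → Fin (n + m) → A × A
joint {n = n} f g = [ f , g ]′ ∘ splitAt n

Meets-joint-edge : (f : Fin n → A × A) (g : Fin m → A × A) (i : Fin n) (j : Fin m) →
                   Meets (joint f g) (edge (i , j)) ⇔ Meet (f i) (g j)
Meets-joint-edge {n = n} {m = m} f g i j = mk⇔ (subst₂ Meet fi gj) (subst₂ Meet (sym fi) (sym gj))
  where
  fi = cong [ f , g ]′ (splitAt-↑ˡ n i m)
  gj = cong [ f , g ]′ (splitAt-↑ʳ n m j)

Realises⇒Satisfies : {M : Matrix n m} {f : Fin n → A × A} {g : Fin m → A × A} →
                     Realises M f g → Satisfies (joint f g) (hitsOf M) (missesOf M)
Realises⇒Satisfies {n = n} {m = m} {M = M} {f} {g} real =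
  map⁺ (All.map (λ {(i , j)} Mij → from (Meets-joint-edge f g i j) (to (real i j) (to T-≡ Mij)))
                (all-filter (T? ∘ uncurry M) (cells n m))) ,
  map⁺ (All.map (λ {(i , j)} ¬Mij met →
                   subst (T ∘ not) (from (real i j) (to (Meets-joint-edge f g i j) met)) ¬Mij)
                (all-filter (T? ∘ not ∘ uncurry M) (cells n m)))

-- readName σ d reads the initial name (toℕ v , b) as the side b of σ v,
-- and any other name as the junk value d.
readSlot : (Fin N → A × A) → A → Bool → {x : ℕ} → Dec (x < N) → A
readSlot σ d b (yes x<N) = σ (fromℕ< x<N) ‼ b
readSlot σ d b (no _)    = d

readName : (Fin N → A × A) → A → Name → A
readName {N = N} σ d (x , b) = readSlot σ d b (x <? N)

readSlot-toℕ : (σ : Fin N → A × A) (d : A) (b : Bool) (v : Fin N) (v<N? : Dec (toℕ v < N)) →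
               readSlot σ d b v<N? ≡ σ v ‼ b
readSlot-toℕ σ d b v (yes v<N) = cong (λ u → σ u ‼ b) (fromℕ<-toℕ v v<N)
readSlot-toℕ σ d b v (no v≮N)  = contradiction (toℕ<n v) v≮N

⟦initial⟧ : (σ : Fin N → A × A) (d : A) (v : Fin N) → σ v ≡ ⟦ initial ⟧ (readName σ d) v
⟦initial⟧ {N = N} σ d v = sym (begin
  map² ρ₀ (lookup initial v)                ≡⟨ cong (map² ρ₀) (lookup∘tabulate _ v) ⟩
  (ρ₀ (toℕ v , false) , ρ₀ (toℕ v , true))  ≡⟨ cong₂ _,_ (read false) (read true) ⟩
  σ v                                       ∎)
  where
  open ≡-Reasoning
  ρ₀ = readName σ d
  read : ∀ b → ρ₀ (toℕ v , b) ≡ σ v ‼ b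
  read b = readSlot-toℕ σ d b v (toℕ v <? N)

refutes-initial-sound : (σ : Fin N → A × A) (ms hs : List (Edge N)) →
                        refutes initial ms hs ≡ true → ¬ Satisfies σ hs ms
refutes-initial-sound σ ms []                ()
refutes-initial-sound σ ms hs@((u , _) ∷ _) ref sat =
  refutes-sound initial ms hs (readName σ (σ u ‼ false)) (from T-≡ ref)
    (Satisfies-resp-≈ (λ v → inj₁ (⟦initial⟧ σ (σ u ‼ false) v)) sat)

Refutable : Matrix n m → Set
Refutable M = refutes initial (missesOf M) (hitsOf M) ≡ true

Refutable⇒¬Realises : {M : Matrix n m} → Refutable M →
                      (f : Fin n → A × A) (g : Fin m → A × A) → ¬ Realises M f g
Refutable⇒¬Realises ref f g real = refutes-initial-sound (joint f g) _ _ ref (Realises⇒Satisfies real)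

-- 2-subsets as pairs

Enumerates : Fin k × Fin k → Subset k → Set
Enumerates P p = (∀ s → P ‼ s ∈ p) × (∀ {x} → x ∈ p → ∃ λ s → x ≡ P ‼ s)

∣p∣≡0⇒x∉p : (p : Subset k) {x : Fin k} → ∣ p ∣ ≡ 0 → x ∉ p
∣p∣≡0⇒x∉p (inside  ∷ p) ()
∣p∣≡0⇒x∉p (outside ∷ p) ∣p∣≡0 (there x∈p) = ∣p∣≡0⇒x∉p p ∣p∣≡0 x∈p

∣p∣≡1⇒singleton : (p : Subset k) → ∣ p ∣ ≡ 1 → ∃ λ x → x ∈ p × (∀ {y} → y ∈ p → y ≡ x)
∣p∣≡1⇒singleton (inside ∷ p) ∣p∣≡1 =
  zero , here , λ { here → refl ; (there y∈p) → contradiction y∈p (∣p∣≡0⇒x∉p p (suc-injective ∣p∣≡1)) }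
∣p∣≡1⇒singleton (outside ∷ p) ∣p∣≡1 with ∣p∣≡1⇒singleton p ∣p∣≡1
... | x , x∈p , unique = suc x , there x∈p , λ { (there y∈p) → cong suc (unique y∈p) }

∣p∣≡2⇒enumerated : (p : Subset k) → ∣ p ∣ ≡ 2 → ∃ λ P → Enumerates P p
∣p∣≡2⇒enumerated (inside ∷ p) ∣p∣≡2 with ∣p∣≡1⇒singleton p (suc-injective ∣p∣≡2)
... | x , x∈p , unique =
  (zero , suc x) , (λ { false → here ; true → there x∈p }) ,
  λ { here → false , refl ; (there y∈p) → true , cong suc (unique y∈p) }
∣p∣≡2⇒enumerated (outside ∷ p) ∣p∣≡2 with ∣p∣≡2⇒enumerated p ∣p∣≡2
... | P , ∈p , complete = map² suc P , (λ { false → there (∈p false) ; true → there (∈p true) }) ,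
  λ { (there y∈p) → Product.map₂ (λ {s} y≡Ps → trans (cong suc y≡Ps) (sym (‼-map² suc P s)))
                                 (complete y∈p) }

Nonempty∩⇔Meet : {P Q : Fin k × Fin k} {p q : Subset k} → Enumerates P p → Enumerates Q q →
                 Nonempty (p ∩ q) ⇔ Meet P Q
Nonempty∩⇔Meet {P = P} {Q} {p} {q} (∈p , p⊆P) (∈q , q⊆Q) = mk⇔ meet nonempty
  where
  meet : Nonempty (p ∩ q) → Meet P Q
  meet (x , x∈p∩q) with x∈p∩q⁻ p q x∈p∩q
  ... | x∈p , x∈q with p⊆P x∈p | q⊆Q x∈q
  ...   | s , x≡Ps | t , x≡Qt = s , t , trans (sym x≡Ps) x≡Qt
  nonempty : Meet P Q → Nonempty (p ∩ q)
  nonempty (s , t , Ps≡Qt) = P ‼ s , x∈p∩q⁺ (∈p s , subst (_∈ q) (sym Ps≡Qt) (∈q t))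

IsSubmatrixOfA⇒Realises : {M : Matrix n m} → IsSubmatrixOfA k 2 M →
                          ∃₂ λ (f : Fin n → Fin k × Fin k) (g : Fin m → Fin k × Fin k) → Realises M f g
IsSubmatrixOfA⇒Realises (F , G , _ , _ , cond) = f , g , λ i j →
  let NE⇔Meet = Nonempty∩⇔Meet (enum (F i)) (enum (G j)) in
  mk⇔ (to NE⇔Meet ∘ proj₁ (cond i j)) (proj₂ (cond i j) ∘ from NE⇔Meet)
  where
  enum : (X : TSubset _ 2) → Enumerates _ (proj₁ X)
  enum (p , ∣p∣≡2) = proj₂ (∣p∣≡2⇒enumerated p ∣p∣≡2)
  f = λ i → proj₁ (∣p∣≡2⇒enumerated (proj₁ (F i)) (proj₂ (F i)))
  g = λ j → proj₁ (∣p∣≡2⇒enumerated (proj₁ (G j)) (proj₂ (G j)))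

Refutable⇒¬IsSubmatrixOfA : {M : Matrix n m} → Refutable M → ¬ IsSubmatrixOfA k 2 M
Refutable⇒¬IsSubmatrixOfA ref sub with IsSubmatrixOfA⇒Realises sub
... | f , g , real = Refutable⇒¬Realises ref f g real

-- The circulant matrices

diffMod-≥ : .{{_ : NonZero n}} (i j : Fin n) → toℕ j ≤ toℕ i → diffMod n i j ≡ toℕ i ∸ toℕ j
diffMod-≥ {n} i j j≤i = begin
  (n + toℕ i ∸ toℕ j) % n     ≡⟨ cong (_% n) (+-∸-assoc n j≤i) ⟩
  (n + (toℕ i ∸ toℕ j)) % n   ≡⟨ cong (_% n) (+-comm n _) ⟩
  (toℕ i ∸ toℕ j + n) % n     ≡⟨ [m+n]%n≡m%n _ n ⟩
  (toℕ i ∸ toℕ j) % n         ≡⟨ m<n⇒m%n≡m (ℕ.≤-<-trans (m∸n≤m (toℕ i) (toℕ j)) (toℕ<n i)) ⟩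
  toℕ i ∸ toℕ j               ∎
  where open ≡-Reasoning

diffMod-< : .{{_ : NonZero n}} (i j : Fin n) → toℕ i < toℕ j → diffMod n i j ≡ n + toℕ i ∸ toℕ j
diffMod-< {n} i j i<j = m<n⇒m%n≡m (subst (n + toℕ i ∸ toℕ j <_) (m+n∸n≡m n (toℕ i))
  (∸-monoʳ-< i<j (≤-trans (ℕ.<⇒≤ (toℕ<n j)) (m≤m+n n (toℕ i)))))

Circ≡ : (p q : ℕ) .{{_ : NonZero (p + q)}} (i j : Fin (p + q)) →
        Circ p q i j ≡ does (diffMod (p + q) i j <? p)
Circ≡ p q i j with diffMod (p + q) i j <? p
... | yes d<p = sym (dec-true (diffMod (p + q) i j <? p) d<p)
... | no d≮p  = sym (dec-false (diffMod (p + q) i j <? p) d≮p)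

p≤diffMod : (p q : ℕ) .{{_ : NonZero (p + q)}} (i j : Fin (p + q)) → toℕ i < toℕ j → toℕ j ≤ q →
            p ≤ diffMod (p + q) i j
p≤diffMod p q i j i<j j≤q = begin
  p                        ≡⟨ m+n∸n≡m p q ⟨
  p + q ∸ q                ≤⟨ ∸-monoʳ-≤ (p + q) j≤q ⟩
  p + q ∸ toℕ j            ≤⟨ ∸-monoˡ-≤ (toℕ j) (m≤m+n (p + q) (toℕ i)) ⟩
  p + q + toℕ i ∸ toℕ j    ≡⟨ diffMod-< i j i<j ⟨
  diffMod (p + q) i j      ∎
  where open ℕ.≤-Reasoning

band : ℕ → ℕ → ℕ → Bool
band p a b = does (b ≤? a) ∧ does (a ∸ b <? p)

Circ-band : (p q : ℕ) .{{_ : NonZero (p + q)}} (i j : Fin (p + q)) → toℕ j ≤ q →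
            Circ p q i j ≡ band p (toℕ i) (toℕ j)
Circ-band p q i j j≤q with toℕ j ≤? toℕ i
... | yes j≤i = begin
  Circ p q i j                      ≡⟨ Circ≡ p q i j ⟩
  does (diffMod (p + q) i j <? p)   ≡⟨ cong (λ d → does (d <? p)) (diffMod-≥ i j j≤i) ⟩
  does (toℕ i ∸ toℕ j <? p)         ≡⟨ cong (_∧ does (toℕ i ∸ toℕ j <? p)) (dec-true (_ ≤? _) j≤i) ⟨
  band p (toℕ i) (toℕ j)            ∎
  where open ≡-Reasoning
... | no j≰i = begin
  Circ p q i j                      ≡⟨ Circ≡ p q i j ⟩
  does (diffMod (p + q) i j <? p)   ≡⟨ dec-false (_ <? p) (ℕ.≤⇒≯ (p≤diffMod p q i j (≰⇒> j≰i) j≤q)) ⟩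
  false                             ≡⟨ cong (_∧ does (toℕ i ∸ toℕ j <? p)) (dec-false (_ ≤? _) j≰i) ⟨
  band p (toℕ i) (toℕ j)            ∎
  where open ≡-Reasoning

Window : Matrix 6 6
Window i j = band 5 (toℕ i) (toℕ j)

block : ∀ r → Fin 6 → Fin (10 + r)
block r i = inject≤ i (m≤m+n 6 (4 + r))

Window⊆Circ : ∀ r (i j : Fin 6) → Window i j ≡ Circ 5 (5 + r) (block r i) (block r j)
Window⊆Circ r i j = sym (begin
  Circ 5 (5 + r) (ι i) (ι j)      ≡⟨ Circ-band 5 (5 + r) (ι i) (ι j) ιj≤5+r ⟩
  band 5 (toℕ (ι i)) (toℕ (ι j))  ≡⟨ cong₂ (band 5) (toℕ-inject≤ i _) (toℕ-inject≤ j _) ⟩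
  band 5 (toℕ i) (toℕ j)          ∎)
  where
  open ≡-Reasoning
  ι = block r
  ιj≤5+r : toℕ (ι j) ≤ 5 + r
  ιj≤5+r = subst (_≤ 5 + r) (sym (toℕ-inject≤ j _)) (≤-trans (toℕ≤pred[n] j) (m≤m+n 5 r))

Circ₅,₂-refutable : Refutable (Circ 5 2)
Circ₅,₂-refutable = refl

Circ₅,₄-refutable : Refutable (Circ 5 4)
Circ₅,₄-refutable = refl

Window-refutable : Refutable Window
Window-refutable = refl

¬IsSubmatrixOfA-Circ₅,₅₊ᵣ : ∀ r → ¬ IsSubmatrixOfA k 2 (Circ 5 (5 + r))
¬IsSubmatrixOfA-Circ₅,₅₊ᵣ r sub with IsSubmatrixOfA⇒Realises sub
... | f , g , real =
  Refutable⇒¬Realises Window-refutable (f ∘ block r) (g ∘ block r)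
    (Realises-submatrix (block r) (block r) (Window⊆Circ r) real)

mainTheorem12 : (q : ℕ) → q ≢ 0 → q ≢ 1 → q ≢ 3 →
    (k : ℕ) → k ≢ 0 → ¬ IsSubmatrixOfA k 2 (Circ ((4 C 2) ∸ 1) q)
mainTheorem12 0 q≢0 _   _   _ _ = contradiction refl q≢0
mainTheorem12 1 _   q≢1 _   _ _ = contradiction refl q≢1
-- M is given explicitly: inferring it would make Agda unfold the search.
mainTheorem12 2 _   _   _   _ _ = Refutable⇒¬IsSubmatrixOfA {M = Circ 5 2} Circ₅,₂-refutable
mainTheorem12 3 _   _   q≢3 _ _ = contradiction refl q≢3
mainTheorem12 4 _   _   _   _ _ = Refutable⇒¬IsSubmatrixOfA {M = Circ 5 4} Circ₅,₄-refutable
mainTheorem12 (suc (suc (suc (suc (suc r))))) _ _ _ _ _ = ¬IsSubmatrixOfA-Circ₅,₅₊ᵣ r
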